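{- If $\langle\varphi(x,y),\langle a_\eta\rangle_{\eta\in{}^{\omega>}2}\rangle$ is an antichain tree (in a monster model of a complete theory $T$), then $\varphi(x,y)$ witnesses $\mathrm{SOP}_1$.
   Context: In ${}^{\omega>}2$, $\unlhd$ is the initial-segment order; a subset $X\subseteq{}^{\omega>}2$ is an antichain if its elements are pairwise $\unlhd$-incomparable. $\langle\varphi(x,y),\langle a_\eta\rangle_{\eta\in{}^{\omega>}2}\rangle$ is an antichain tree if for all $X\subseteq{}^{\omega>}2$, $\{\varphi(x,a_\eta):\eta\in X\}$ is consistent if and only if $X$ is an antichain. $\varphi$ witnesses $\mathrm{SOP}_1$ if there is a tree $\langle b_\eta\rangle_{\eta\in{}^{\omega>}2}$ such that for every $\eta\in{}^\omega2$, $\{\varphi(x,b_{\eta\lceil n}):n<\omega\}$ is consistent, and for all $\eta,\nu\in{}^{\omega>}2$, $\{\varphi(x,b_{\eta^\frown\langle1\rangle}),\varphi(x,b_{\eta^\frown\langle0\rangle^\frown\nu})\}$ is inconsistent. -}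

module Defs where

open import Data.Bool using (Bool; false; true)
open import Data.List using (List; []; _∷_; _++_; [_]; applyUpTo)
open import Data.List.Relation.Binary.Prefix.Heterogeneous using (Prefix)
open import Data.Nat using (ℕ)
open import Data.Product using (Σ; ∃; _×_; _,_)
open import Data.Unit using (⊤)
open import Data.Vec using (Vec)
open import Relation.Binary.PropositionalEquality using (_≡_)
open import Relation.Nullary using (¬_)

-- ^{ω>}2 : finite binary sequences (false = 0, true = 1)
Node : Set
Node = List Bool

Branch : Set
Branch = ℕ → Bool

_⌈_ : Branch → ℕ → Node
η ⌈ n = applyUpTo η n

_⊴_ : Node → Node → Set
η ⊴ ν = Prefix _≡_ η ν

Antichain : (Node → Set) → Set
Antichain X = ∀ η ν → X η → X ν → η ⊴ ν → η ≡ ν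

-- Standing setting: a monster model with universe M; φ(x,y) with |x| = n, |y| = m
-- is given by its interpretation φ ⊆ M^n × M^m.  A (small) set of instances
-- { φ(x, b i) : i ∈ S } is consistent iff it is realized in the monster model.
Consistent : {M : Set} {n m : ℕ} (φ : Vec M n → Vec M m → Set)
             {I : Set} (b : I → Vec M m) (S : I → Set) → Set
Consistent {M} {n} φ b S = Σ (Vec M n) λ x → ∀ i → S i → φ x (b i)

IsAntichainTree : {M : Set} {n m : ℕ} (φ : Vec M n → Vec M m → Set)
                  (a : Node → Vec M m) → Set₁
IsAntichainTree φ a =
  ∀ (X : Node → Set) → (Consistent φ a X → Antichain X) × (Antichain X → Consistent φ a X)

Pair : {M : Set} {m : ℕ} → Vec M m → Vec M m → Bool → Vec M m
Pair p q false = p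
Pair p q true  = q

WitnessesSOP1 : {M : Set} {n m : ℕ} (φ : Vec M n → Vec M m → Set) → Set
WitnessesSOP1 {M} {n} {m} φ =
  Σ (Node → Vec M m) λ b →
    (∀ (η : Branch) → Consistent φ (λ k → b (η ⌈ k)) (λ _ → ⊤))
    × (∀ (η ν : Node) →
         ¬ Consistent φ (Pair (b (η ++ [ true ])) (b ((η ++ [ false ]) ++ ν))) (λ _ → ⊤))

{-# OPTIONS --safe #-}
module Submission where

open import Defs
open import Data.Bool using (Bool; true; false)
open import Data.List using ([]; _∷_; _++_; [_])
open import Data.List.Properties using (++-assoc; ++-identityʳ-unique)
open import Data.List.Relation.Binary.Pointwise as Pointwise using ()
open import Data.List.Relation.Binary.Prefix.Heterogeneous using ([]; _∷_; _++ᵖ_)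
open import Data.List.Relation.Binary.Prefix.Heterogeneous.Properties using (fromPointwise; ++⁻)
open import Data.Nat using (ℕ; suc; _≤_; z≤n; s≤s)
open import Data.Nat.Properties using (≤-total)
open import Data.Product using (∃; _,_; proj₁; proj₂)
open import Data.Sum as Sum using (_⊎_; inj₁; inj₂)
open import Data.Unit using (⊤; tt)
open import Data.Vec using (Vec)
open import Function using (_∘_)
open import Relation.Binary.PropositionalEquality using (_≡_; _≢_; refl; sym; trans; cong; subst; module ≡-Reasoning)
open import Relation.Nullary using (¬_)

-- Re-index the antichain tree along the map `embed`, which codes 1 as 0 and
-- 0 as 01 and closes the word with a 1.  Distinct nodes on one branch are sent
-- to ⊴-incomparable nodes (the longer code has a 0 where the shorter one ends
-- in 1), so every branch is consistent.  The code of η⌢0⌢ν, however, is the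
-- code of η⌢1 followed by the code of ν, so the two formulas of an SOP₁ pair
-- are indexed by a proper ⊴-chain and are inconsistent.

code : Bool → Node
code true  = false ∷ []
code false = false ∷ true ∷ []

embed : Node → Node
embed []      = true ∷ []
embed (b ∷ η) = code b ++ embed η

embed≢[] : ∀ η → embed η ≢ []
embed≢[] []          ()
embed≢[] (true  ∷ η) ()
embed≢[] (false ∷ η) ()

embed-++-false : ∀ η ν → embed ((η ++ [ false ]) ++ ν) ≡ embed (η ++ [ true ]) ++ embed ν
embed-++-false []      ν = refl
embed-++-false (b ∷ η) ν = begin
  code b ++ embed ((η ++ [ false ]) ++ ν)     ≡⟨ cong (code b ++_) (embed-++-false η ν) ⟩
  code b ++ (embed (η ++ [ true ]) ++ embed ν) ≡⟨ sym (++-assoc (code b) _ _) ⟩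
  (code b ++ embed (η ++ [ true ])) ++ embed ν ∎
  where open ≡-Reasoning

Comparable : Node → Node → Set
Comparable η ν = η ⊴ ν ⊎ ν ⊴ η

embed-⊴⇒≡ : ∀ {η ν} → Comparable η ν → embed η ⊴ embed ν → η ≡ ν
embed-⊴⇒≡ {[]}        {[]}        _                 _ = refl
embed-⊴⇒≡ {[]}        {true  ∷ _} _                 (() ∷ _)
embed-⊴⇒≡ {[]}        {false ∷ _} _                 (() ∷ _)
embed-⊴⇒≡ {true  ∷ _} {[]}        _                 (() ∷ _)
embed-⊴⇒≡ {false ∷ _} {[]}        _                 (() ∷ _)
embed-⊴⇒≡ {b ∷ _}     {_ ∷ _}     (inj₁ (refl ∷ p)) q =
  cong (b ∷_) (embed-⊴⇒≡ (inj₁ p) (++⁻ {as = code b} refl q))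
embed-⊴⇒≡ {b ∷ _}     {_ ∷ _}     (inj₂ (refl ∷ p)) q =
  cong (b ∷_) (embed-⊴⇒≡ (inj₂ p) (++⁻ {as = code b} refl q))

⌈-mono : ∀ (η : Branch) {k k′} → k ≤ k′ → (η ⌈ k) ⊴ (η ⌈ k′)
⌈-mono η z≤n       = []
⌈-mono η (s≤s k≤k′) = refl ∷ ⌈-mono (η ∘ suc) k≤k′

⌈-comparable : ∀ (η : Branch) k k′ → Comparable (η ⌈ k) (η ⌈ k′)
⌈-comparable η k k′ = Sum.map (⌈-mono η) (⌈-mono η) (≤-total k k′)

embed-branch-antichain : ∀ (η : Branch) → Antichain (λ w → ∃ λ k → w ≡ embed (η ⌈ k))
embed-branch-antichain η _ _ (k , refl) (k′ , refl) p =
  cong embed (embed-⊴⇒≡ (⌈-comparable η k k′) p)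

proper-extension-not-antichain : ∀ {u v w : Node} → v ≡ u ++ w → w ≢ [] →
                                 ¬ Antichain (λ x → x ≡ u ⊎ x ≡ v)
proper-extension-not-antichain {u} {v} {w} v≡uw w≢[] antichain =
  w≢[] (++-identityʳ-unique u (trans u≡v v≡uw))
  where
  u⊴v : u ⊴ v
  u⊴v = subst (u ⊴_) (sym v≡uw) (fromPointwise (Pointwise.refl refl) ++ᵖ w)
  u≡v : u ≡ v
  u≡v = antichain u v (inj₁ refl) (inj₂ refl) u⊴v

pair-consistent : ∀ {M : Set} {n m} (φ : Vec M n → Vec M m → Set) (a : Node → Vec M m) {u v} →
                  Consistent φ (Pair (a u) (a v)) (λ _ → ⊤) →
                  Consistent φ a (λ x → x ≡ u ⊎ x ≡ v)
pair-consistent φ a (x , h) = x , λ { _ (inj₁ refl) → h false tt ; _ (inj₂ refl) → h true tt }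

proposition4p4 : {M : Set} {n m : ℕ} (φ : Vec M n → Vec M m → Set) (a : Node → Vec M m)
    → IsAntichainTree φ a → WitnessesSOP1 φ
proposition4p4 φ a tree = a ∘ embed , branch-consistent , pair-inconsistent
  where
  branch-consistent : ∀ (η : Branch) → Consistent φ (λ k → a (embed (η ⌈ k))) (λ _ → ⊤)
  branch-consistent η with proj₂ (tree _) (embed-branch-antichain η)
  ... | x , h = x , λ k _ → h _ (k , refl)

  pair-inconsistent : ∀ η ν →
    ¬ Consistent φ (Pair (a (embed (η ++ [ true ]))) (a (embed ((η ++ [ false ]) ++ ν)))) (λ _ → ⊤)
  pair-inconsistent η ν =
    proper-extension-not-antichain (embed-++-false η ν) (embed≢[] ν)
    ∘ proj₁ (tree _) ∘ pair-consistent φ a
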